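{- Let $n\ge 3$ and $X\in\{LD,LTD\}$. Then $\gamma_X(K_{1,n})=n$ and $\gamma_X(M(K_{1,n}))=2n$.
   Context: For a graph $G=(V,E)$ and $x\in V$, $N(x)$ is the open neighbourhood and $N[x]=N(x)\cup\{x\}$. A set $C\subseteq V$ is a locating-dominating set ($LD$-set) if $N[x]\cap C\ne\emptyset$ for all $x\in V$ and $N(x)\cap C\ne N(y)\cap C$ for all distinct $x,y\in V\setminus C$; it is a locating total-dominating set ($LTD$-set) if $N(x)\cap C\ne\emptyset$ for all $x\in V$ and $N(x)\cap C\ne N(y)\cap C$ for all distinct $x,y\in V\setminus C$. $\gamma_X(G)$ is the minimum size of an $X$-set of $G$. $K_{1,n}$ is the star with one centre and $n$ leaves. The Mycielski graph $M(G)$ of $G$ with $V=\{v_1,\dots,v_m\}$ is obtained from $G$ by adding, for each $i$, a new vertex $u_i$ adjacent to every vertex of $N_G(v_i)$, and then adding one further vertex $u$ adjacent to all of $u_1,\dots,u_m$ (and to nothing else). -}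

module Defs where

open import Data.Nat using (ℕ; zero; suc; _+_; _≤_)
open import Data.Bool using (Bool; true; false; _xor_)
open import Data.Fin using (Fin; zero; suc; splitAt)
open import Data.Fin.Subset using (Subset; _∈_; _∉_; ∣_∣)
open import Data.Sum using (_⊎_; inj₁; inj₂)
open import Data.Product using (_×_; ∃; ∃-syntax)
open import Relation.Binary.PropositionalEquality using (_≡_; _≢_)
open import Relation.Nullary using (¬_)
open import Function.Bundles using (_⇔_)

-- A (finite, simple) graph on vertex set Fin m, given by its adjacency function.
-- (Only applied below to concrete symmetric, irreflexive adjacency functions.)
Graph : ℕ → Set
Graph m = Fin m → Fin m → Bool

Adj : ∀ {m} → Graph m → Fin m → Fin m → Set
Adj G x y = G x y ≡ true

OpenDom : ∀ {m} → Graph m → Subset m → Fin m → Set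
OpenDom G C x = ∃[ y ] (Adj G x y × y ∈ C)

ClosedDom : ∀ {m} → Graph m → Subset m → Fin m → Set
ClosedDom G C x = x ∈ C ⊎ OpenDom G C x

SameTrace : ∀ {m} → Graph m → Subset m → Fin m → Fin m → Set
SameTrace G C x y = ∀ z → z ∈ C → (Adj G x z ⇔ Adj G y z)

Locating : ∀ {m} → Graph m → Subset m → Set
Locating G C = ∀ x y → x ≢ y → x ∉ C → y ∉ C → ¬ SameTrace G C x y

IsLD : ∀ {m} → Graph m → Subset m → Set
IsLD G C = (∀ x → ClosedDom G C x) × Locating G C

IsLTD : ∀ {m} → Graph m → Subset m → Set
IsLTD G C = (∀ x → OpenDom G C x) × Locating G C

data Kind : Set where
  LD LTD : Kind

IsXSet : Kind → ∀ {m} → Graph m → Subset m → Set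
IsXSet LD  G C = IsLD G C
IsXSet LTD G C = IsLTD G C

γ≡ : Kind → ∀ {m} → Graph m → ℕ → Set
γ≡ X {m} G k = (∃[ C ] (IsXSet X G C × ∣ C ∣ ≡ k)) × (∀ (C : Subset m) → IsXSet X G C → k ≤ ∣ C ∣)

isZero : ∀ {m} → Fin m → Bool
isZero zero    = true
isZero (suc _) = false

-- Star K_{1,n}: vertex 0 is the centre, vertices 1..n are the leaves.
star : (n : ℕ) → Graph (suc n)
star n x y = isZero x xor isZero y

-- Mycielski graph M(G) on Fin (suc (m + m)):
-- zero = u ; suc (inject i) for i in first block = v_i ; second block = u_i.
mycielski : ∀ {m} → Graph m → Graph (suc (m + m))
mycielski {m} G = adj
  where
  adj : Graph (suc (m + m))
  adj zero    zero    = false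
  adj zero    (suc y) with splitAt m y
  ... | inj₁ _ = false
  ... | inj₂ _ = true
  adj (suc x) zero    with splitAt m x
  ... | inj₁ _ = false
  ... | inj₂ _ = true
  adj (suc x) (suc y) with splitAt m x | splitAt m y
  ... | inj₁ i | inj₁ j = G i j
  ... | inj₁ i | inj₂ j = G i j
  ... | inj₂ i | inj₁ j = G i j
  ... | inj₂ i | inj₂ j = false

module Submission where

open import Defs
open import Data.Bool using (Bool; true; false; T; _∨_; _∧_)
open import Data.Bool.Properties using (T-∨; T-∧; not-¬)
open import Data.Empty using (⊥-elim)
open import Data.Fin using (Fin; zero; suc; splitAt; _↑ˡ_; _↑ʳ_; _≟_)
open import Data.Fin.Properties
  using (suc-injective; ↑ˡ-injective; ↑ʳ-injective; splitAt-↑ˡ; splitAt-↑ʳ; splitAt⁻¹-↑ˡ;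
         splitAt⁻¹-↑ʳ)
open import Data.Fin.Subset using (Subset; inside; outside; _∈_; _∉_; ∣_∣; ⊤)
open import Data.Fin.Subset.Properties
  using (_∈?_; drop-there; ∈⊤; ∣⊤∣≡n; p⊆q⇒∣p∣≤∣q∣)
open import Data.Nat using (ℕ; zero; suc; _+_; _*_; _≤_; z≤n; s≤s)
open import Data.Nat.Properties
  using (≤-refl; ≤-trans; ≤-reflexive; +-suc; +-identityʳ; +-mono-≤; +-monoˡ-≤;
         module ≤-Reasoning)
open import Data.Nat.Tactic.RingSolver using (solve-∀)
open import Data.Product using (_×_; _,_; proj₁; proj₂; ∃-syntax)
open import Data.Sum using (_⊎_; inj₁; inj₂)
open import Data.Vec using (_∷_; []; _++_; lookup; here; there)
import Data.Vec as Vec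
open import Data.Vec.Properties using ([]=⇒lookup; lookup⇒[]=; lookup-++ˡ; lookup-++ʳ)
open import Function using (_∘_)
open import Function.Bundles using (_⇔_; mk⇔; Equivalence)
open import Relation.Binary.PropositionalEquality
  using (_≡_; _≢_; refl; sym; trans; subst; cong; cong₂; module ≡-Reasoning)
open import Relation.Nullary using (¬_; yes; no)
open import Relation.Nullary.Decidable using (T?)

open Equivalence using (to; from)

-- Twins (vertices with the same open neighbourhood) cannot both lie outside a locating
-- set. The leaves of K_{1,n} are pairwise twins, so an LD-set misses at most one of them,
-- and if it misses one it must contain the centre to dominate it. In M(K_{1,n}), with
-- centre v₀, its shadow u₀ and apex u, the leaves and the shadows of the leaves form two
-- twin classes of size n. A missed leaf forces v₀ or u₀ into the set, a missed leaf
-- shadow forces u or v₀, and a missed leaf together with a missed leaf shadow forces u or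
-- u₀ to tell them apart; so at most |C ∩ {u, v₀, u₀}| vertices of the twin classes are
-- missed. Both bounds are attained by LTD-sets missing one vertex of each twin class
-- (and u₀).

bit : Bool → ℕ
bit false = 0
bit true  = 1

bit-mono : ∀ {p c} → (T p → T c) → bit p ≤ bit c
bit-mono {false}         _   = z≤n
bit-mono {true}  {true}  _   = ≤-refl
bit-mono {true}  {false} p⇒c = ⊥-elim (p⇒c _)

holes≤dominators : ∀ p q x y z →
                   (T p → T (y ∨ z)) → (T q → T (x ∨ y)) → (T (p ∧ q) → T (x ∨ z)) →
                   bit p + bit q ≤ bit x + bit y + bit z
holes≤dominators false false _     _     _     _  _  _   = z≤n
holes≤dominators true  false true  _     _     _  _  _   = s≤s z≤n
holes≤dominators true  false false true  _     _  _  _   = s≤s z≤n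
holes≤dominators true  false false false true  _  _  _   = s≤s z≤n
holes≤dominators true  false false false false hp _  _   = ⊥-elim (hp _)
holes≤dominators false true  true  _     _     _  _  _   = s≤s z≤n
holes≤dominators false true  false true  _     _  _  _   = s≤s z≤n
holes≤dominators false true  false false _     _  hq _   = ⊥-elim (hq _)
holes≤dominators true  true  true  true  _     _  _  _   = s≤s (s≤s z≤n)
holes≤dominators true  true  true  false true  _  _  _   = s≤s (s≤s z≤n)
holes≤dominators true  true  false true  true  _  _  _   = s≤s (s≤s z≤n)
holes≤dominators true  true  _     false false hp _  _   = ⊥-elim (hp _)
holes≤dominators true  true  false _     false _  _  hpq = ⊥-elim (hpq _)
holes≤dominators true  true  false false true  _  hq _   = ⊥-elim (hq _)

∣∷∣≡ : ∀ {k} c (p : Subset k) → ∣ c ∷ p ∣ ≡ bit c + ∣ p ∣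
∣∷∣≡ inside  p = refl
∣∷∣≡ outside p = refl

∣++∣≡ : ∀ {k l} (p : Subset k) (q : Subset l) → ∣ p ++ q ∣ ≡ ∣ p ∣ + ∣ q ∣
∣++∣≡ []            q = refl
∣++∣≡ (inside  ∷ p) q = cong suc (∣++∣≡ p q)
∣++∣≡ (outside ∷ p) q = ∣++∣≡ p q

zero∈∷⇔T : ∀ {k c} {p : Subset k} → zero ∈ c ∷ p ⇔ T c
zero∈∷⇔T {c = true}  = mk⇔ (λ _ → _) (λ _ → here)
zero∈∷⇔T {c = false} = mk⇔ (λ ()) (λ ())

lookup≡⇒∈⇔ : ∀ {k l} {p : Subset k} {q : Subset l} {x y} →
             lookup p x ≡ lookup q y → x ∈ p ⇔ y ∈ q
lookup≡⇒∈⇔ {p = p} {q} {x} {y} e =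
  mk⇔ (λ x∈p → lookup⇒[]= y q (trans (sym e) ([]=⇒lookup x∈p)))
      (λ y∈q → lookup⇒[]= x p (trans e ([]=⇒lookup y∈q)))

AtMostOneOutside : ∀ {k} → Subset k → Set
AtMostOneOutside p = ∀ {i j} → i ∉ p → j ∉ p → i ≡ j

almost-full : ∀ {k} (p : Subset k) → AtMostOneOutside p →
              ∃[ h ] (k ≤ bit h + ∣ p ∣ × (T h → ∃[ i ] i ∉ p))
almost-full []            _   = false , z≤n , λ ()
almost-full (inside ∷ p)  amo
  with almost-full p (λ i∉ j∉ → suc-injective (amo (i∉ ∘ drop-there) (j∉ ∘ drop-there)))
... | h , k≤ , hole =
  h , ≤-trans (s≤s k≤) (≤-reflexive (sym (+-suc (bit h) ∣ p ∣))) ,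
  λ t → let (i , i∉) = hole t in suc i , i∉ ∘ drop-there
almost-full {suc k} (outside ∷ p) amo = true , s≤s k≤∣p∣ , λ _ → zero , λ ()
  where
  all-inside : ∀ i → i ∈ p
  all-inside i with i ∈? p
  ... | yes i∈ = i∈
  ... | no  i∉ with amo {suc i} {zero} (i∉ ∘ drop-there) (λ ())
  ...   | ()
  k≤∣p∣ : k ≤ ∣ p ∣
  k≤∣p∣ = subst (_≤ ∣ p ∣) (∣⊤∣≡n k) (p⊆q⇒∣p∣≤∣q∣ {p = ⊤} λ {i} _ → all-inside i)

IsXSet⇒IsLD : ∀ X {m} {G : Graph m} {C} → IsXSet X G C → IsLD G C
IsXSet⇒IsLD LD  isLD        = isLD
IsXSet⇒IsLD LTD (dom , loc) = (λ x → inj₂ (dom x)) , loc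

IsLTD⇒IsXSet : ∀ X {m} {G : Graph m} {C} → IsLTD G C → IsXSet X G C
IsLTD⇒IsXSet LD  isLTD = IsXSet⇒IsLD LTD isLTD
IsLTD⇒IsXSet LTD isLTD = isLTD

γ≡-squeeze : ∀ X {m} {G : Graph m} {C k} → IsLTD G C → ∣ C ∣ ≡ k →
             (∀ D → IsLD G D → k ≤ ∣ D ∣) → γ≡ X G k
γ≡-squeeze X {C = C} isLTD ∣C∣≡k lower =
  (C , IsLTD⇒IsXSet X isLTD , ∣C∣≡k) , λ D isX → lower D (IsXSet⇒IsLD X isX)

Twins : ∀ {m} → Graph m → Fin m → Fin m → Set
Twins G x y = ∀ z → G x z ≡ G y z

agree⇒SameTrace : ∀ {m} (G : Graph m) {C} x y →
                  (∀ z → z ∈ C → G x z ≡ G y z) → SameTrace G C x y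
agree⇒SameTrace G x y agree z z∈C =
  mk⇔ (λ xz → trans (sym (agree z z∈C)) xz) (λ yz → trans (agree z z∈C) yz)

separates : ∀ {m} (G : Graph m) {C} x y {z} → z ∈ C → G x z ≡ false → G y z ≡ true →
            ¬ SameTrace G C x y × ¬ SameTrace G C y x
separates G x y z∈C xz yz =
  (λ same → not-¬ xz (from (same _ z∈C) yz)) ,
  (λ same → not-¬ xz (to (same _ z∈C) yz))

single-outside⇒Locating : ∀ {m} {G : Graph m} {C} w →
                          (∀ {x} → x ∉ C → x ≡ w) → Locating G C
single-outside⇒Locating w only-w x y x≢y x∉ y∉ _ = x≢y (trans (only-w x∉) (sym (only-w y∉)))

twin-class-atMostOneOutside : ∀ {m k} {G : Graph m} {C} {p : Subset k} → Locating G C →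
  (f : Fin k → Fin m) → (∀ {i j} → f i ≡ f j → i ≡ j) → (∀ i j → Twins G (f i) (f j)) →
  (∀ {i} → f i ∈ C → i ∈ p) → AtMostOneOutside p
twin-class-atMostOneOutside {G = G} loc f f-injective twins f∈⇒∈ {i} {j} i∉ j∉
  with i ≟ j
... | yes i≡j = i≡j
... | no  i≢j = ⊥-elim (loc (f i) (f j) (i≢j ∘ f-injective) (i∉ ∘ f∈⇒∈) (j∉ ∘ f∈⇒∈)
                          (agree⇒SameTrace G (f i) (f j) λ z _ → twins i j z))

star-lower : ∀ {n} (C : Subset (suc n)) → IsLD (star n) C → n ≤ ∣ C ∣
star-lower {n} (c ∷ leaves) (dom , loc)
  with almost-full leaves (twin-class-atMostOneOutside loc suc suc-injective (λ _ _ _ → refl) drop-there)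
... | h , n≤ , hole = begin
  n                  ≤⟨ n≤ ⟩
  bit h + ∣ leaves ∣ ≤⟨ +-monoˡ-≤ ∣ leaves ∣ (bit-mono (centre-in ∘ hole)) ⟩
  bit c + ∣ leaves ∣ ≡⟨ sym (∣∷∣≡ c leaves) ⟩
  ∣ c ∷ leaves ∣     ∎
  where
  open ≤-Reasoning
  centre-in : ∃[ i ] i ∉ leaves → T c
  centre-in (i , i∉) with dom (suc i)
  ... | inj₁ i∈               = ⊥-elim (i∉ (drop-there i∈))
  ... | inj₂ (zero , _ , z∈)  = to zero∈∷⇔T z∈
  ... | inj₂ (suc _ , () , _)

star-set : ∀ k → Subset (suc (suc (suc k)))
star-set k = inside ∷ outside ∷ ⊤

star-set-isLTD : ∀ k → IsLTD (star (suc (suc k))) (star-set k)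
star-set-isLTD k = dom , single-outside⇒Locating (suc zero) only-leaf₁
  where
  dom : ∀ x → OpenDom (star (suc (suc k))) (star-set k) x
  dom zero    = suc (suc zero) , refl , there (there ∈⊤)
  dom (suc _) = zero , refl , here
  only-leaf₁ : ∀ {x} → x ∉ star-set k → x ≡ suc zero
  only-leaf₁ {zero}        x∉ = ⊥-elim (x∉ here)
  only-leaf₁ {suc zero}    _  = refl
  only-leaf₁ {suc (suc _)} x∉ = ⊥-elim (x∉ (there (there ∈⊤)))

∣star-set∣ : ∀ k → ∣ star-set k ∣ ≡ suc (suc k)
∣star-set∣ k = cong suc (∣⊤∣≡n (suc k))

apex : ∀ {m} → Fin (suc (m + m))
apex = zero

orig : ∀ {m} → Fin m → Fin (suc (m + m))
orig {m} i = suc (i ↑ˡ m)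

shadow : ∀ {m} → Fin m → Fin (suc (m + m))
shadow {m} j = suc (m ↑ʳ j)

data MycielskiVertex {m : ℕ} : Fin (suc (m + m)) → Set where
  is-apex   : MycielskiVertex (apex {m})
  is-orig   : (i : Fin m) → MycielskiVertex (orig i)
  is-shadow : (j : Fin m) → MycielskiVertex (shadow j)

mycielskiVertex : ∀ {m} x → MycielskiVertex {m} x
mycielskiVertex     zero    = is-apex
mycielskiVertex {m} (suc y) with splitAt m y in eq
... | inj₁ i = subst (MycielskiVertex ∘ suc) (splitAt⁻¹-↑ˡ eq) (is-orig i)
... | inj₂ j = subst (MycielskiVertex ∘ suc) (splitAt⁻¹-↑ʳ eq) (is-shadow j)

orig-injective : ∀ {m} {i j : Fin m} → orig i ≡ orig j → i ≡ j
orig-injective {m} = ↑ˡ-injective m _ _ ∘ suc-injective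

shadow-injective : ∀ {m} {i j : Fin m} → shadow i ≡ shadow j → i ≡ j
shadow-injective {m} = ↑ʳ-injective m _ _ ∘ suc-injective

orig≢shadow : ∀ {m} {i j : Fin m} → orig i ≢ shadow j
orig≢shadow {m} {i} {j} e
  with trans (sym (splitAt-↑ˡ m i m))
             (trans (cong (splitAt m) (suc-injective e)) (splitAt-↑ʳ m m j))
... | ()

orig∈⇔ : ∀ {m c i} (xs ys : Subset m) → orig i ∈ c ∷ xs ++ ys ⇔ i ∈ xs
orig∈⇔ {i = i} xs ys = lookup≡⇒∈⇔ (lookup-++ˡ xs ys i)

shadow∈⇔ : ∀ {m c j} (xs ys : Subset m) → shadow j ∈ c ∷ xs ++ ys ⇔ j ∈ ys
shadow∈⇔ {j = j} xs ys = lookup≡⇒∈⇔ (lookup-++ʳ xs ys j)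

module _ {m : ℕ} (G : Graph m) where

  private
    M = mycielski G

  orig-orig : (i j : Fin m) → M (orig i) (orig j) ≡ G i j
  orig-orig i j rewrite splitAt-↑ˡ m i m | splitAt-↑ˡ m j m = refl

  orig-shadow : (i j : Fin m) → M (orig i) (shadow j) ≡ G i j
  orig-shadow i j rewrite splitAt-↑ˡ m i m | splitAt-↑ʳ m m j = refl

  shadow-orig : (i j : Fin m) → M (shadow i) (orig j) ≡ G i j
  shadow-orig i j rewrite splitAt-↑ʳ m m i | splitAt-↑ˡ m j m = refl

  shadow-shadow : (i j : Fin m) → M (shadow i) (shadow j) ≡ false
  shadow-shadow i j rewrite splitAt-↑ʳ m m i | splitAt-↑ʳ m m j = refl

  orig-apex : (i : Fin m) → M (orig i) (apex {m}) ≡ false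
  orig-apex i rewrite splitAt-↑ˡ m i m = refl

  shadow-apex : (j : Fin m) → M (shadow j) (apex {m}) ≡ true
  shadow-apex j rewrite splitAt-↑ʳ m m j = refl

  apex-shadow : (j : Fin m) → M (apex {m}) (shadow j) ≡ true
  apex-shadow j rewrite splitAt-↑ʳ m m j = refl

  orig-twins : ∀ {i j} → Twins G i j → Twins M (orig i) (orig j)
  orig-twins {i} {j} twins z with mycielskiVertex {m} z
  ... | is-apex     rewrite orig-apex i     | orig-apex j     = refl
  ... | is-orig k   rewrite orig-orig i k   | orig-orig j k   = twins k
  ... | is-shadow k rewrite orig-shadow i k | orig-shadow j k = twins k

  shadow-twins : ∀ {i j} → Twins G i j → Twins M (shadow i) (shadow j)
  shadow-twins {i} {j} twins z with mycielskiVertex {m} z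
  ... | is-apex     rewrite shadow-apex i     | shadow-apex j     = refl
  ... | is-orig k   rewrite shadow-orig i k   | shadow-orig j k   = twins k
  ... | is-shadow k rewrite shadow-shadow i k | shadow-shadow j k = refl

∣∷∷++∷∣≡ : ∀ {k} cu cv₀ cu₀ (vs us : Subset k) →
           ∣ cu ∷ (cv₀ ∷ vs) ++ (cu₀ ∷ us) ∣ ≡ (bit cu + bit cv₀ + bit cu₀) + (∣ vs ∣ + ∣ us ∣)
∣∷∷++∷∣≡ cu cv₀ cu₀ vs us = begin
  ∣ cu ∷ (cv₀ ∷ vs) ++ (cu₀ ∷ us) ∣
    ≡⟨ ∣∷∣≡ cu ((cv₀ ∷ vs) ++ (cu₀ ∷ us)) ⟩
  bit cu + ∣ (cv₀ ∷ vs) ++ (cu₀ ∷ us) ∣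
    ≡⟨ cong (bit cu +_) (∣++∣≡ (cv₀ ∷ vs) (cu₀ ∷ us)) ⟩
  bit cu + (∣ cv₀ ∷ vs ∣ + ∣ cu₀ ∷ us ∣)
    ≡⟨ cong₂ (λ a b → bit cu + (a + b)) (∣∷∣≡ cv₀ vs) (∣∷∣≡ cu₀ us) ⟩
  bit cu + ((bit cv₀ + ∣ vs ∣) + (bit cu₀ + ∣ us ∣))
    ≡⟨ regroup (bit cu) (bit cv₀) (bit cu₀) (∣ vs ∣) (∣ us ∣) ⟩
  (bit cu + bit cv₀ + bit cu₀) + (∣ vs ∣ + ∣ us ∣)
    ∎
  where
  open ≡-Reasoning
  regroup : ∀ a b c d e → a + ((b + d) + (c + e)) ≡ (a + b + c) + (d + e)
  regroup = solve-∀

module _ {n : ℕ} {cu cv₀ cu₀ : Bool} {vs us : Subset n} where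

  private
    M : Graph (suc (suc n + suc n))
    M = mycielski (star n)

    C : Subset (suc (suc n + suc n))
    C = cu ∷ (cv₀ ∷ vs) ++ (cu₀ ∷ us)

    v u : Fin (suc n) → Fin (suc (suc n + suc n))
    v = orig
    u = shadow

    v∈C⇔ : ∀ {i} → v i ∈ C ⇔ i ∈ cv₀ ∷ vs
    v∈C⇔ = orig∈⇔ (cv₀ ∷ vs) (cu₀ ∷ us)

    u∈C⇔ : ∀ {j} → u j ∈ C ⇔ j ∈ cu₀ ∷ us
    u∈C⇔ = shadow∈⇔ (cv₀ ∷ vs) (cu₀ ∷ us)

    leaf-neighbours : ∀ a z → Adj M (v (suc a)) z → z ≡ v zero ⊎ z ≡ u zero
    leaf-neighbours a z adj with mycielskiVertex {suc n} z
    ... | is-apex           = ⊥-elim (not-¬ (orig-apex (star n) (suc a)) adj)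
    ... | is-orig zero      = inj₁ refl
    ... | is-orig (suc k)   = ⊥-elim (not-¬ (orig-orig (star n) (suc a) (suc k)) adj)
    ... | is-shadow zero    = inj₂ refl
    ... | is-shadow (suc k) = ⊥-elim (not-¬ (orig-shadow (star n) (suc a) (suc k)) adj)

    leaf-shadow-neighbours : ∀ a z → Adj M (u (suc a)) z → z ≡ apex {suc n} ⊎ z ≡ v zero
    leaf-shadow-neighbours a z adj with mycielskiVertex {suc n} z
    ... | is-apex         = inj₁ refl
    ... | is-orig zero    = inj₂ refl
    ... | is-orig (suc k) = ⊥-elim (not-¬ (shadow-orig (star n) (suc a) (suc k)) adj)
    ... | is-shadow k     = ⊥-elim (not-¬ (shadow-shadow (star n) (suc a) k) adj)

    leaf-and-leaf-shadow-same-trace : ∀ a b → ¬ T cu → ¬ T cu₀ →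
                                      SameTrace M C (v (suc a)) (u (suc b))
    leaf-and-leaf-shadow-same-trace a b u∉C u₀∉C =
      agree⇒SameTrace M (v (suc a)) (u (suc b)) agree
      where
      agree : ∀ z → z ∈ C → M (v (suc a)) z ≡ M (u (suc b)) z
      agree z z∈C with mycielskiVertex {suc n} z
      ... | is-apex           = ⊥-elim (u∉C (to zero∈∷⇔T z∈C))
      ... | is-orig k         =
        trans (orig-orig (star n) (suc a) k) (sym (shadow-orig (star n) (suc b) k))
      ... | is-shadow zero    = ⊥-elim (u₀∉C (to zero∈∷⇔T (to u∈C⇔ z∈C)))
      ... | is-shadow (suc k) =
        trans (orig-shadow (star n) (suc a) (suc k)) (sym (shadow-shadow (star n) (suc b) (suc k)))

    missing-leaf⇒v₀∨u₀ : (∀ x → ClosedDom M C x) → ∃[ i ] i ∉ vs → T (cv₀ ∨ cu₀)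
    missing-leaf⇒v₀∨u₀ dom (i , i∉) with dom (v (suc i))
    ... | inj₁ i∈ = ⊥-elim (i∉ (drop-there (to v∈C⇔ i∈)))
    ... | inj₂ (z , adj , z∈) with leaf-neighbours i z adj
    ...   | inj₁ refl = from T-∨ (inj₁ (to zero∈∷⇔T (to v∈C⇔ z∈)))
    ...   | inj₂ refl = from T-∨ (inj₂ (to zero∈∷⇔T (to u∈C⇔ z∈)))

    missing-leaf-shadow⇒u∨v₀ : (∀ x → ClosedDom M C x) → ∃[ j ] j ∉ us → T (cu ∨ cv₀)
    missing-leaf-shadow⇒u∨v₀ dom (j , j∉) with dom (u (suc j))
    ... | inj₁ j∈ = ⊥-elim (j∉ (drop-there (to u∈C⇔ j∈)))
    ... | inj₂ (z , adj , z∈) with leaf-shadow-neighbours j z adj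
    ...   | inj₁ refl = from T-∨ (inj₁ (to zero∈∷⇔T z∈))
    ...   | inj₂ refl = from T-∨ (inj₂ (to zero∈∷⇔T (to v∈C⇔ z∈)))

    missing-both⇒u∨u₀ : Locating M C → ∃[ i ] i ∉ vs → ∃[ j ] j ∉ us → T (cu ∨ cu₀)
    missing-both⇒u∨u₀ loc (i , i∉) (j , j∉) with T? cu | T? cu₀
    ... | yes u∈C | _        = from T-∨ (inj₁ u∈C)
    ... | no _    | yes u₀∈C = from T-∨ (inj₂ u₀∈C)
    ... | no u∉C  | no u₀∉C  =
      ⊥-elim (loc (v (suc i)) (u (suc j)) orig≢shadow (i∉ ∘ drop-there ∘ to v∈C⇔)
                  (j∉ ∘ drop-there ∘ to u∈C⇔) (leaf-and-leaf-shadow-same-trace i j u∉C u₀∉C))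

  mycielski-star-lower-blocks : IsLD M C → 2 * n ≤ ∣ C ∣
  mycielski-star-lower-blocks (dom , loc)
    with almost-full vs (twin-class-atMostOneOutside loc (v ∘ suc) (suc-injective ∘ orig-injective)
                                                     (λ _ _ → orig-twins (star n) λ _ → refl)
                                                     (drop-there ∘ to v∈C⇔))
       | almost-full us (twin-class-atMostOneOutside loc (u ∘ suc) (suc-injective ∘ shadow-injective)
                                                     (λ _ _ → shadow-twins (star n) λ _ → refl)
                                                     (drop-there ∘ to u∈C⇔))
  ... | p , n≤vs , p-hole | q , n≤us , q-hole = begin
    2 * n                                            ≡⟨ cong (n +_) (+-identityʳ n) ⟩
    n + n                                            ≤⟨ +-mono-≤ n≤vs n≤us ⟩
    (bit p + ∣ vs ∣) + (bit q + ∣ us ∣)              ≡⟨ interchange (bit p) _ (bit q) _ ⟩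
    (bit p + bit q) + (∣ vs ∣ + ∣ us ∣)              ≤⟨ +-monoˡ-≤ (∣ vs ∣ + ∣ us ∣) holes≤ ⟩
    (bit cu + bit cv₀ + bit cu₀) + (∣ vs ∣ + ∣ us ∣) ≡⟨ sym (∣∷∷++∷∣≡ cu cv₀ cu₀ vs us) ⟩
    ∣ C ∣                                            ∎
    where
    open ≤-Reasoning
    interchange : ∀ a b c d → (a + b) + (c + d) ≡ (a + c) + (b + d)
    interchange = solve-∀
    holes≤ : bit p + bit q ≤ bit cu + bit cv₀ + bit cu₀
    holes≤ = holes≤dominators p q cu cv₀ cu₀
      (missing-leaf⇒v₀∨u₀ dom ∘ p-hole) (missing-leaf-shadow⇒u∨v₀ dom ∘ q-hole)
      (λ pq → let (tp , tq) = to T-∧ pq in missing-both⇒u∨u₀ loc (p-hole tp) (q-hole tq))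

mycielski-star-lower : ∀ {n} (C : Subset (suc (suc n + suc n))) →
                       IsLD (mycielski (star n)) C → 2 * n ≤ ∣ C ∣
mycielski-star-lower {n} (cu ∷ rest) with Vec.splitAt (suc n) rest
... | cv₀ ∷ vs , cu₀ ∷ us , refl = mycielski-star-lower-blocks

module _ (k : ℕ) where

  private
    n : ℕ
    n = suc (suc k)

    G : Graph (suc n)
    G = star n

    M : Graph (suc (suc n + suc n))
    M = mycielski G

    v u : Fin (suc n) → Fin (suc (suc n + suc n))
    v = orig
    u = shadow

    leaves shadows : Subset (suc n)
    leaves  = inside  ∷ outside ∷ ⊤
    shadows = outside ∷ outside ∷ ⊤

  mycielski-star-set : Subset (suc (suc n + suc n))
  mycielski-star-set = inside ∷ leaves ++ shadows

  private
    C = mycielski-star-set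

    v∈C : ∀ {i} → i ∈ leaves → v i ∈ C
    v∈C = from (orig∈⇔ leaves shadows)

    u∈C : ∀ {j} → j ∈ shadows → u j ∈ C
    u∈C = from (shadow∈⇔ leaves shadows)

    outside-cases : ∀ {x} → x ∉ C → x ≡ v (suc zero) ⊎ x ≡ u (suc zero) ⊎ x ≡ u zero
    outside-cases {x} x∉ with mycielskiVertex {suc n} x
    ... | is-apex                 = ⊥-elim (x∉ here)
    ... | is-orig zero            = ⊥-elim (x∉ (v∈C here))
    ... | is-orig (suc zero)      = inj₁ refl
    ... | is-orig (suc (suc _))   = ⊥-elim (x∉ (v∈C (there (there ∈⊤))))
    ... | is-shadow zero          = inj₂ (inj₂ refl)
    ... | is-shadow (suc zero)    = inj₂ (inj₁ refl)
    ... | is-shadow (suc (suc _)) = ⊥-elim (x∉ (u∈C (there (there ∈⊤))))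

    v₁≁u₁ : ¬ SameTrace M C (v (suc zero)) (u (suc zero)) ×
            ¬ SameTrace M C (u (suc zero)) (v (suc zero))
    v₁≁u₁ = separates M (v (suc zero)) (u (suc zero)) here
                      (orig-apex G (suc zero)) (shadow-apex G (suc zero))

    u₀≁v₁ : ¬ SameTrace M C (u zero) (v (suc zero)) × ¬ SameTrace M C (v (suc zero)) (u zero)
    u₀≁v₁ = separates M (u zero) (v (suc zero)) (v∈C here)
                      (shadow-orig G zero zero) (orig-orig G (suc zero) zero)

    u₀≁u₁ : ¬ SameTrace M C (u zero) (u (suc zero)) × ¬ SameTrace M C (u (suc zero)) (u zero)
    u₀≁u₁ = separates M (u zero) (u (suc zero)) (v∈C here)
                      (shadow-orig G zero zero) (shadow-orig G (suc zero) zero)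

    locating : Locating M C
    locating x y x≢y x∉ y∉ with outside-cases x∉ | outside-cases y∉
    ... | inj₁ refl        | inj₁ refl        = ⊥-elim (x≢y refl)
    ... | inj₁ refl        | inj₂ (inj₁ refl) = proj₁ v₁≁u₁
    ... | inj₁ refl        | inj₂ (inj₂ refl) = proj₂ u₀≁v₁
    ... | inj₂ (inj₁ refl) | inj₁ refl        = proj₂ v₁≁u₁
    ... | inj₂ (inj₁ refl) | inj₂ (inj₁ refl) = ⊥-elim (x≢y refl)
    ... | inj₂ (inj₁ refl) | inj₂ (inj₂ refl) = proj₂ u₀≁u₁
    ... | inj₂ (inj₂ refl) | inj₁ refl        = proj₁ u₀≁v₁
    ... | inj₂ (inj₂ refl) | inj₂ (inj₁ refl) = proj₁ u₀≁u₁
    ... | inj₂ (inj₂ refl) | inj₂ (inj₂ refl) = ⊥-elim (x≢y refl)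

    dominating : ∀ x → OpenDom M C x
    dominating x with mycielskiVertex {suc n} x
    ... | is-apex           =
      u (suc (suc zero)) , apex-shadow G (suc (suc zero)) , u∈C (there (there ∈⊤))
    ... | is-orig zero      =
      v (suc (suc zero)) , orig-orig G zero (suc (suc zero)) , v∈C (there (there ∈⊤))
    ... | is-orig (suc i)   = v zero , orig-orig G (suc i) zero , v∈C here
    ... | is-shadow zero    = apex {suc n} , shadow-apex G zero , here
    ... | is-shadow (suc j) = v zero , shadow-orig G (suc j) zero , v∈C here

  mycielski-star-set-isLTD : IsLTD M mycielski-star-set
  mycielski-star-set-isLTD = dominating , locating

  ∣mycielski-star-set∣ : ∣ mycielski-star-set ∣ ≡ 2 * n
  ∣mycielski-star-set∣ = begin
    suc ∣ leaves ++ shadows ∣               ≡⟨ cong suc (∣++∣≡ leaves shadows) ⟩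
    suc (suc ∣ ⊤ {suc k} ∣ + ∣ ⊤ {suc k} ∣) ≡⟨ cong (λ t → suc (suc t + t)) (∣⊤∣≡n (suc k)) ⟩
    suc (suc (suc k) + suc k)               ≡⟨ double (suc k) ⟩
    2 * n                                   ∎
    where
    open ≡-Reasoning
    double : ∀ t → suc (suc t + t) ≡ 2 * suc t
    double = solve-∀

theorem4 : (n : ℕ) → 3 ≤ n → (X : Kind) →
    γ≡ X (star n) n × γ≡ X (mycielski (star n)) (2 * n)
theorem4 (suc (suc (suc k))) (s≤s (s≤s (s≤s _))) X =
  γ≡-squeeze X (star-set-isLTD (suc k)) (∣star-set∣ (suc k)) star-lower ,
  γ≡-squeeze X (mycielski-star-set-isLTD (suc k)) (∣mycielski-star-set∣ (suc k))
                mycielski-star-lower
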